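{- For every $n\ge 1$, the number of integer sequences $e=(e_1,\dots,e_n)$ with $0\le e_i<i$ for all $i\in[n]$ such that there are no indices $i<j<k$ with $e_i\ne e_j$, $e_j<e_k$ and $e_i\ne e_k$ equals $2^{n+1}-\binom{n+1}{3}-2n-1$. -}

module Defs where

open import Data.Nat using (ℕ; suc; _<_)
open import Data.Fin using (Fin; toℕ)
open import Data.Product using (∃-syntax; _×_)
open import Data.Vec using (Vec; lookup)
open import Relation.Binary.PropositionalEquality using (_≢_)
open import Relation.Nullary using (¬_)

-- An integer sequence e = (e_1,...,e_n) is stored as a vector of naturals,
-- position p : Fin n (0-based) holding e_{p+1}.
Seq : ℕ → Set
Seq n = Vec ℕ n

IsInvSeq : ∀ {n} → Seq n → Set
IsInvSeq {n} e = (p : Fin n) → lookup e p < suc (toℕ p)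

HasPattern : ∀ {n} → Seq n → Set
HasPattern {n} e =
  ∃[ i ] ∃[ j ] ∃[ k ]
    (toℕ i < toℕ j × toℕ j < toℕ k ×
     lookup e i ≢ lookup e j × lookup e j < lookup e k × lookup e i ≢ lookup e k)

Avoids : ∀ {n} → Seq n → Set
Avoids e = ¬ HasPattern e

-- Whether a value x may be appended to an avoiding inversion sequence depends only on
-- a coarse shape of the sequence read so far: all zeros (anything may follow); zeros
-- followed by a block of some c ≥ 1 (anything ≤ c); such a block followed by a weakly
-- decreasing run of positive values below c ending in d (anything ≤ d); a block of c
-- followed by a 0 (only 0 and c); or a run followed by a 0 (only 0). The avoiding
-- sequences of each length are thus generated, together with their shapes, by a
-- transition function on shapes, which gives a duplicate-free enumeration. Counting is
-- done with weights on shapes. Among the sequences of length n+1 there is one all-zero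
-- sequence and there are C(n+1,2) block shapes; the number E(n) of shapes "block then 0"
-- obeys E(n+1) = C(n+1,2) + 2 E(n); and a weight f(m) on the blocks and runs whose last
-- value is m+1 totals Σ_{j<n} 2^(n-1-j) f(j). Such a block or run has m+2 extensions, the
-- all-zero sequence n+2, a "block then 0" two and the rest one, so the number T(n) of
-- sequences satisfies T(n+1) = T(n) + (n+1) + E(n) + Σ_{j<n} 2^(n-1-j) (j+1), which solves
-- to the stated closed form.
module Submission where

open import Algebra.Properties.CommutativeSemigroup using (interchange; x∙yz≈y∙xz)
open import Data.Empty using (⊥; ⊥-elim)
open import Data.Fin using (Fin; zero; suc; toℕ; inject₁; fromℕ)
open import Data.Fin.Properties using (toℕ-inject₁; toℕ-fromℕ; toℕ<n; toℕ≤pred[n])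
open import Data.List using (List; []; _∷_; _++_; map; concatMap; downFrom; length)
open import Data.List.Membership.Propositional using (_∈_; find; lose)
open import Data.List.Membership.Propositional.Properties
  using (∈-map⁻; ∈-map⁺; ∈-concatMap⁻; ∈-concatMap⁺; ∈-downFrom⁻; ∈-downFrom⁺)
open import Data.List.Properties using (map-++; map-∘; map-cong; length-map)
open import Data.List.Relation.Unary.All as All using ([]; _∷_)
open import Data.List.Relation.Unary.AllPairs using ([]; _∷_)
open import Data.List.Relation.Unary.Any using (here; there)
open import Data.List.Relation.Unary.Unique.Propositional using (Unique)
open import Data.List.Relation.Unary.Unique.Propositional.Properties using (map⁺; ++⁺; downFrom⁺)
open import Data.Nat
  using (ℕ; zero; suc; _+_; _*_; _∸_; _^_; _<_; _≤_; _≥_; z≤n; s≤s; s≤s⁻¹; _≟_; _≤?_)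
open import Data.Nat.Combinatorics using (_C_; nC1≡n; nCk+nC[k+1]≡[n+1]C[k+1])
open import Data.Nat.ListAction using (sum)
open import Data.Nat.ListAction.Properties using (sum-++)
open import Data.Nat.Properties
open import Data.Nat.Tactic.RingSolver using (solve-∀)
open import Data.Product using (Σ; ∃-syntax; _×_; _,_; proj₁; proj₂)
open import Data.Sum using (_⊎_; inj₁; inj₂; [_,_]′)
open import Data.Unit using (⊤; tt)
open import Data.Vec using (Vec; []; _∷_; _∷ʳ_; lookup; initLast)
open import Data.Vec.Properties using (∷ʳ-injectiveˡ; ∷ʳ-injectiveʳ)
open import Function using (_∘_)
open import Relation.Binary.PropositionalEquality
open import Relation.Nullary using (¬_; Dec; yes; no; contradiction)
open import Relation.Nullary.Decidable using (decidable-stable)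

open import Defs

Pattern : ℕ → ℕ → ℕ → Set
Pattern a b c = a ≢ b × b < c × a ≢ c

pattern-cong : ∀ {a b c a′ b′ c′} → a ≡ a′ → b ≡ b′ → c ≡ c′ →
               Pattern a b c → Pattern a′ b′ c′
pattern-cong refl refl refl p = p

Forbidden : ∀ {k} → Vec ℕ k → ℕ → Set
Forbidden e x = ∃[ i ] ∃[ j ] (toℕ i < toℕ j × Pattern (lookup e i) (lookup e j) x)

Confined : ∀ {k} → Vec ℕ k → ℕ → Set
Confined e x = ∀ i → lookup e i ≡ 0 ⊎ lookup e i ≡ x

Escapes : ∀ {k} → Vec ℕ k → ℕ → ℕ → Set
Escapes e y x = ∃[ i ] (lookup e i ≢ y × lookup e i ≢ x)

confined⇒¬escapes : ∀ {k} {e : Vec ℕ k} {x} → Confined e x → ¬ Escapes e 0 x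
confined⇒¬escapes c (i , ≢0 , ≢x) = [ ≢0 , ≢x ]′ (c i)

isInvSeq⇒head≡0 : ∀ {k} {e : Vec ℕ (suc k)} → IsInvSeq e → lookup e zero ≡ 0
isInvSeq⇒head≡0 inv = n<1⇒n≡0 (inv zero)

head-escapes : ∀ {k} {e : Vec ℕ (suc k)} {y x} →
               lookup e zero ≡ 0 → 0 < y → y < x → Escapes e y x
head-escapes e₀≡0 0<y y<x =
  zero , (λ e₀≡y → <-irrefl (trans (sym e₀≡0) e₀≡y) 0<y) ,
         (λ e₀≡x → <-irrefl (trans (sym e₀≡0) e₀≡x) (<-trans 0<y y<x))

data SnocView {k} : Fin (suc k) → Set where
  old : (j : Fin k) → SnocView (inject₁ j)
  new : SnocView (fromℕ k)

snocView : ∀ {k} (i : Fin (suc k)) → SnocView i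
snocView {zero} zero = new
snocView {suc k} zero = old zero
snocView {suc k} (suc i) with snocView i
... | old j = old (suc j)
... | new = new

<⇒inject₁ : ∀ {k} (i j : Fin (suc k)) → toℕ i < toℕ j → ∃[ i′ ] i ≡ inject₁ i′
<⇒inject₁ i j i<j with snocView i
... | old i′ = i′ , refl
... | new = ⊥-elim (<⇒≱ i<j (subst (toℕ j ≤_) (sym (toℕ-fromℕ _)) (toℕ≤pred[n] j)))

inject₁-<⁺ : ∀ {k} {i j : Fin k} → toℕ i < toℕ j → toℕ (inject₁ i) < toℕ (inject₁ j)
inject₁-<⁺ {i = i} {j} = subst₂ _<_ (sym (toℕ-inject₁ i)) (sym (toℕ-inject₁ j))

inject₁-<⁻ : ∀ {k} {i j : Fin k} → toℕ (inject₁ i) < toℕ (inject₁ j) → toℕ i < toℕ j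
inject₁-<⁻ {i = i} {j} = subst₂ _<_ (toℕ-inject₁ i) (toℕ-inject₁ j)

inject₁<fromℕ : ∀ {k} (i : Fin k) → toℕ (inject₁ i) < toℕ (fromℕ k)
inject₁<fromℕ {k} i = subst₂ _<_ (sym (toℕ-inject₁ i)) (sym (toℕ-fromℕ k)) (toℕ<n i)

lookup-∷ʳ-inject₁ : ∀ {A : Set} {k} (e : Vec A k) y j → lookup (e ∷ʳ y) (inject₁ j) ≡ lookup e j
lookup-∷ʳ-inject₁ (_ ∷ _) y zero = refl
lookup-∷ʳ-inject₁ (_ ∷ e) y (suc j) = lookup-∷ʳ-inject₁ e y j

lookup-∷ʳ-fromℕ : ∀ {A : Set} {k} (e : Vec A k) y → lookup (e ∷ʳ y) (fromℕ k) ≡ y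
lookup-∷ʳ-fromℕ [] y = refl
lookup-∷ʳ-fromℕ (_ ∷ e) y = lookup-∷ʳ-fromℕ e y

module Snoc {k} (e : Vec ℕ k) (y : ℕ) where

  private
    at-old : ∀ j → lookup (e ∷ʳ y) (inject₁ j) ≡ lookup e j
    at-old = lookup-∷ʳ-inject₁ e y

    at-new : lookup (e ∷ʳ y) (fromℕ k) ≡ y
    at-new = lookup-∷ʳ-fromℕ e y

  hasPattern⁻ : HasPattern (e ∷ʳ y) → HasPattern e ⊎ Forbidden e y
  hasPattern⁻ (i , j , l , i<j , j<l , p)
    with <⇒inject₁ i j i<j | <⇒inject₁ j l j<l | snocView l
  ... | i′ , refl | j′ , refl | old l′ =
    inj₁ (i′ , j′ , l′ , inject₁-<⁻ i<j , inject₁-<⁻ j<l ,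
          pattern-cong (at-old i′) (at-old j′) (at-old l′) p)
  ... | i′ , refl | j′ , refl | new =
    inj₂ (i′ , j′ , inject₁-<⁻ i<j , pattern-cong (at-old i′) (at-old j′) at-new p)

  hasPattern⁺ : HasPattern e → HasPattern (e ∷ʳ y)
  hasPattern⁺ (i , j , l , i<j , j<l , p) =
    inject₁ i , inject₁ j , inject₁ l , inject₁-<⁺ i<j , inject₁-<⁺ j<l ,
    pattern-cong (sym (at-old i)) (sym (at-old j)) (sym (at-old l)) p

  forbidden⇒hasPattern : Forbidden e y → HasPattern (e ∷ʳ y)
  forbidden⇒hasPattern (i , j , i<j , p) =
    inject₁ i , inject₁ j , fromℕ k , inject₁-<⁺ i<j , inject₁<fromℕ j ,
    pattern-cong (sym (at-old i)) (sym (at-old j)) (sym at-new) p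

  forbidden⁻ : ∀ {x} → Forbidden (e ∷ʳ y) x → Forbidden e x ⊎ (y < x × Escapes e y x)
  forbidden⁻ (i , j , i<j , p) with <⇒inject₁ i j i<j | snocView j
  ... | i′ , refl | old j′ =
    inj₁ (i′ , j′ , inject₁-<⁻ i<j , pattern-cong (at-old i′) (at-old j′) refl p)
  ... | i′ , refl | new with pattern-cong (at-old i′) at-new refl p
  ...   | ≢y , y<x , ≢x = inj₂ (y<x , i′ , ≢y , ≢x)

  forbidden⁺ : ∀ {x} → Forbidden e x → Forbidden (e ∷ʳ y) x
  forbidden⁺ (i , j , i<j , p) =
    inject₁ i , inject₁ j , inject₁-<⁺ i<j , pattern-cong (sym (at-old i)) (sym (at-old j)) refl p

  escapes⇒forbidden : ∀ {x} → y < x → Escapes e y x → Forbidden (e ∷ʳ y) x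
  escapes⇒forbidden y<x (i , ≢y , ≢x) =
    inject₁ i , fromℕ k , inject₁<fromℕ i ,
    pattern-cong (sym (at-old i)) (sym at-new) refl (≢y , y<x , ≢x)

  confined⁺ : ∀ {x} → Confined e x → y ≡ 0 ⊎ y ≡ x → Confined (e ∷ʳ y) x
  confined⁺ c y∈ i with snocView i
  ... | old j rewrite at-old j = c j
  ... | new rewrite at-new = y∈

  escapes⁺ : ∀ {z x} → Escapes e z x → Escapes (e ∷ʳ y) z x
  escapes⁺ (i , ≢z , ≢x) =
    inject₁ i , subst (_≢ _) (sym (at-old i)) ≢z , subst (_≢ _) (sym (at-old i)) ≢x

  last-escapes : ∀ {z x} → y ≢ z → y ≢ x → Escapes (e ∷ʳ y) z x
  last-escapes ≢z ≢x = fromℕ k , subst (_≢ _) (sym at-new) ≢z , subst (_≢ _) (sym at-new) ≢x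

  isInvSeq⁺ : IsInvSeq e → y < suc k → IsInvSeq (e ∷ʳ y)
  isInvSeq⁺ inv y≤k i with snocView i
  ... | old j rewrite at-old j | toℕ-inject₁ j = inv j
  ... | new rewrite at-new | toℕ-fromℕ k = y≤k

  isInvSeq⁻ : IsInvSeq (e ∷ʳ y) → IsInvSeq e × y < suc k
  isInvSeq⁻ inv =
    (λ j → subst₂ _<_ (at-old j) (cong suc (toℕ-inject₁ j)) (inv (inject₁ j))) ,
    subst₂ _<_ at-new (cong suc (toℕ-fromℕ k)) (inv (fromℕ k))

-- Shapes

-- With c = suc m: zeros = 0…0, plateau m = 0…0 c…c, descent m = a plateau of a larger
-- value followed by a weakly decreasing positive run ending in c, twoValued m = a plateau
-- of c followed by a 0 and then entries from {0, c}, frozen = a descent followed by 0…0.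
data Shape : Set where
  zeros : Shape
  plateau descent twoValued : ℕ → Shape
  frozen : Shape

step : Shape → ℕ → Shape
step zeros zero = zeros
step zeros (suc j) = plateau j
step (plateau m) zero = twoValued m
step (plateau m) (suc j) with j ≟ m
... | yes _ = plateau m
... | no _ = descent j
step (descent m) zero = frozen
step (descent m) (suc j) = descent j
step (twoValued v) _ = twoValued v
step frozen _ = frozen

Allowed : Shape → ℕ → Set
Allowed zeros x = ⊤
Allowed (plateau m) x = x ≤ suc m
Allowed (descent m) x = x ≤ suc m
Allowed (twoValued v) x = x ≡ 0 ⊎ x ≡ suc v
Allowed frozen x = x ≡ 0

Confines : Shape → ℕ → Set
Confines zeros x = ⊤
Confines (plateau m) x = x ≡ suc m
Confines (descent m) x = ⊥
Confines (twoValued v) x = x ≡ suc v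
Confines frozen x = ⊥

allowed? : ∀ s x → Dec (Allowed s x)
allowed? zeros x = yes tt
allowed? (plateau m) x = x ≤? suc m
allowed? (descent m) x = x ≤? suc m
allowed? (twoValued v) x with x ≟ 0 | x ≟ suc v
... | yes x≡0 | _ = yes (inj₁ x≡0)
... | no _ | yes x≡v = yes (inj₂ x≡v)
... | no x≢0 | no x≢v = no [ x≢0 , x≢v ]′
allowed? frozen x = x ≟ 0

confines? : ∀ s x → Dec (Confines s x)
confines? zeros x = yes tt
confines? (plateau m) x = x ≟ suc m
confines? (descent m) x = no λ ()
confines? (twoValued v) x = x ≟ suc v
confines? frozen x = no λ ()

-- Appending y newly forbids the x > y for which some earlier entry differs from both y
-- and x. As an inversion sequence starts with 0, for y > 0 that is every x > y, and for
-- y = 0 every x such that the sequence is not confined to {0, x}.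
step-allowed⁻ : ∀ s y {x} → Allowed s y → Allowed (step s y) x →
                Allowed s x × (x ≤ y ⊎ y ≡ 0 × Confines s x)
step-allowed⁻ zeros zero _ _ = tt , inj₂ (refl , tt)
step-allowed⁻ zeros (suc j) _ x≤y = tt , inj₁ x≤y
step-allowed⁻ (plateau m) zero _ (inj₁ refl) = z≤n , inj₁ z≤n
step-allowed⁻ (plateau m) zero _ (inj₂ refl) = ≤-refl , inj₂ (refl , refl)
step-allowed⁻ (plateau m) (suc j) y≤m x≤ with j ≟ m
... | yes refl = x≤ , inj₁ x≤
... | no _ = ≤-trans x≤ y≤m , inj₁ x≤
step-allowed⁻ (descent m) zero _ refl = z≤n , inj₁ z≤n
step-allowed⁻ (descent m) (suc j) y≤m x≤y = ≤-trans x≤y y≤m , inj₁ x≤y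
step-allowed⁻ (twoValued v) y _ (inj₁ refl) = inj₁ refl , inj₁ z≤n
step-allowed⁻ (twoValued v) y (inj₁ refl) (inj₂ refl) = inj₂ refl , inj₂ (refl , refl)
step-allowed⁻ (twoValued v) y (inj₂ refl) (inj₂ refl) = inj₂ refl , inj₁ ≤-refl
step-allowed⁻ frozen y _ refl = refl , inj₁ z≤n

step-allowed⁺ : ∀ s y {x} → Allowed s x → (x ≤ y ⊎ y ≡ 0 × Confines s x) →
                Allowed (step s y) x
step-allowed⁺ zeros zero _ _ = tt
step-allowed⁺ zeros (suc j) _ (inj₁ x≤y) = x≤y
step-allowed⁺ (plateau m) zero _ (inj₁ x≤0) = inj₁ (n≤0⇒n≡0 x≤0)
step-allowed⁺ (plateau m) zero _ (inj₂ (_ , x≡m)) = inj₂ x≡m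
step-allowed⁺ (plateau m) (suc j) x≤m x≤y with j ≟ m
... | yes _ = x≤m
step-allowed⁺ (plateau m) (suc j) x≤m (inj₁ x≤y) | no _ = x≤y
step-allowed⁺ (descent m) zero _ (inj₁ x≤0) = n≤0⇒n≡0 x≤0
step-allowed⁺ (descent m) (suc j) _ (inj₁ x≤y) = x≤y
step-allowed⁺ (twoValued v) y ax _ = ax
step-allowed⁺ frozen y ax _ = ax

step-confines⁻ : ∀ s y {x} → Allowed s y → Confines (step s y) x →
                 Confines s x × (y ≡ 0 ⊎ y ≡ x)
step-confines⁻ zeros zero _ _ = tt , inj₁ refl
step-confines⁻ zeros (suc j) _ refl = tt , inj₂ refl
step-confines⁻ (plateau m) zero _ c = c , inj₁ refl
step-confines⁻ (plateau m) (suc j) _ c with j ≟ m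
step-confines⁻ (plateau m) (suc j) _ refl | yes refl = refl , inj₂ refl
step-confines⁻ (twoValued v) y (inj₁ y≡0) c = c , inj₁ y≡0
step-confines⁻ (twoValued v) y (inj₂ refl) refl = refl , inj₂ refl

step-confines⁺ : ∀ s y {x} → Confines s x → (y ≡ 0 ⊎ y ≡ x) → Confines (step s y) x
step-confines⁺ zeros zero _ _ = tt
step-confines⁺ zeros (suc j) _ (inj₂ refl) = refl
step-confines⁺ (plateau m) zero c _ = c
step-confines⁺ (plateau m) (suc j) c y≡x with j ≟ m
... | yes _ = c
step-confines⁺ (plateau m) (suc j) refl (inj₂ y≡x) | no j≢m = j≢m (suc-injective y≡x)
step-confines⁺ (twoValued v) y c _ = c

Bounded : Shape → ℕ → Set
Bounded zeros k = ⊤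
Bounded (plateau m) k = suc m < k
Bounded (descent m) k = suc m < k
Bounded (twoValued v) k = suc v < k
Bounded frozen k = ⊤

step-bounded : ∀ s y {k} → Bounded s k → y < suc k → Allowed s y → Bounded (step s y) (suc k)
step-bounded zeros zero _ _ _ = tt
step-bounded zeros (suc j) _ y≤k _ = y≤k
step-bounded (plateau m) zero b _ _ = m<n⇒m<1+n b
step-bounded (plateau m) (suc j) b y≤k _ with j ≟ m
... | yes _ = m<n⇒m<1+n b
... | no _ = y≤k
step-bounded (descent m) zero _ _ _ = tt
step-bounded (descent m) (suc j) _ y≤k _ = y≤k
step-bounded (twoValued v) y b _ _ = m<n⇒m<1+n b
step-bounded frozen y _ _ _ = tt

record Tracks {k} (e : Vec ℕ k) (s : Shape) : Set where
  field
    isInvSeq : IsInvSeq e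
    avoids : Avoids e
    allowed⇒¬forbidden : ∀ {x} → Allowed s x → ¬ Forbidden e x
    ¬allowed⇒forbidden : ∀ {x} → ¬ Allowed s x → Forbidden e x
    confines⇒confined : ∀ {x} → Confines s x → Confined e x
    ¬confines⇒escapes : ∀ {x} → ¬ Confines s x → Escapes e 0 x
    bounded : Bounded s k

tracks-[0] : Tracks (0 ∷ []) zeros
tracks-[0] = record
  { isInvSeq = λ { zero → s≤s z≤n }
  ; avoids = λ { (zero , zero , _ , () , _) }
  ; allowed⇒¬forbidden = λ { _ (zero , zero , () , _) }
  ; ¬allowed⇒forbidden = λ ¬tt → contradiction tt ¬tt
  ; confines⇒confined = λ { _ zero → inj₁ refl }
  ; ¬confines⇒escapes = λ ¬tt → contradiction tt ¬tt
  ; bounded = tt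
  }

step-newly-forbidden : ∀ {k} {e : Vec ℕ (suc k)} {s} → Tracks e s → ∀ y {x} →
                       Allowed s x → ¬ Allowed (step s y) x → y < x × Escapes e y x
step-newly-forbidden {e = e} {s} t y {x} ax nax = y<x , escapes y y<x nax
  where
  open Tracks t
  y<x : y < x
  y<x = ≰⇒> (λ x≤y → nax (step-allowed⁺ s y ax (inj₁ x≤y)))
  escapes : ∀ y → y < x → ¬ Allowed (step s y) x → Escapes e y x
  escapes zero _ nax = ¬confines⇒escapes (λ c → nax (step-allowed⁺ s 0 ax (inj₂ (refl , c))))
  escapes (suc j) y<x _ = head-escapes {e = e} (isInvSeq⇒head≡0 {e = e} isInvSeq) (s≤s z≤n) y<x

tracks-∷ʳ : ∀ {k} {e : Vec ℕ (suc k)} {s y} → Tracks e s → y < suc (suc k) → Allowed s y →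
            Tracks (e ∷ʳ y) (step s y)
tracks-∷ʳ {k} {e} {s} {y} t y≤1+k ay = record
  { isInvSeq = isInvSeq⁺ isInvSeq y≤1+k
  ; avoids = [ avoids , allowed⇒¬forbidden ay ]′ ∘ hasPattern⁻
  ; allowed⇒¬forbidden = allowed⇒¬forbidden′
  ; ¬allowed⇒forbidden = ¬allowed⇒forbidden′
  ; confines⇒confined = confines⇒confined′
  ; ¬confines⇒escapes = ¬confines⇒escapes′
  ; bounded = step-bounded s y bounded y≤1+k ay
  }
  where
  open Tracks t
  open Snoc e y

  allowed⇒¬forbidden′ : ∀ {x} → Allowed (step s y) x → ¬ Forbidden (e ∷ʳ y) x
  allowed⇒¬forbidden′ ax f with step-allowed⁻ s y ay ax | forbidden⁻ f
  ... | ax′ , _ | inj₁ f′ = allowed⇒¬forbidden ax′ f′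
  ... | _ , inj₁ x≤y | inj₂ (y<x , _) = <⇒≱ y<x x≤y
  ... | _ , inj₂ (refl , c) | inj₂ (_ , esc) = confined⇒¬escapes {e = e} (confines⇒confined c) esc

  ¬allowed⇒forbidden′ : ∀ {x} → ¬ Allowed (step s y) x → Forbidden (e ∷ʳ y) x
  ¬allowed⇒forbidden′ {x} nax with allowed? s x
  ... | no nax′ = forbidden⁺ (¬allowed⇒forbidden nax′)
  ... | yes ax = let y<x , esc = step-newly-forbidden t y ax nax in escapes⇒forbidden y<x esc

  confines⇒confined′ : ∀ {x} → Confines (step s y) x → Confined (e ∷ʳ y) x
  confines⇒confined′ c =
    let c′ , y∈ = step-confines⁻ s y ay c in confined⁺ (confines⇒confined c′) y∈

  ¬confines⇒escapes′ : ∀ {x} → ¬ Confines (step s y) x → Escapes (e ∷ʳ y) 0 x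
  ¬confines⇒escapes′ {x} nc with confines? s x
  ... | no nc′ = escapes⁺ (¬confines⇒escapes nc′)
  ... | yes c = last-escapes (λ y≡0 → nc (step-confines⁺ s y c (inj₁ y≡0)))
                             (λ y≡x → nc (step-confines⁺ s y c (inj₂ y≡x)))

-- Enumeration

choices : Shape → ℕ → List ℕ
choices zeros k = downFrom (suc k)
choices (plateau m) _ = downFrom (suc (suc m))
choices (descent m) _ = downFrom (suc (suc m))
choices (twoValued v) _ = 0 ∷ suc v ∷ []
choices frozen _ = 0 ∷ []

choices-sound : ∀ s {k y} → Bounded s k → y ∈ choices s k → y < suc k × Allowed s y
choices-sound zeros _ y∈ = ∈-downFrom⁻ y∈ , tt
choices-sound (plateau m) b y∈ =
  let y≤c = s≤s⁻¹ (∈-downFrom⁻ y∈) in m<n⇒m<1+n (≤-<-trans y≤c b) , y≤c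
choices-sound (descent m) b y∈ =
  let y≤c = s≤s⁻¹ (∈-downFrom⁻ y∈) in m<n⇒m<1+n (≤-<-trans y≤c b) , y≤c
choices-sound (twoValued v) b (here refl) = s≤s z≤n , inj₁ refl
choices-sound (twoValued v) b (there (here refl)) = m<n⇒m<1+n b , inj₂ refl
choices-sound frozen b (here refl) = s≤s z≤n , refl

choices-complete : ∀ s {k y} → y < suc k → Allowed s y → y ∈ choices s k
choices-complete zeros y≤k _ = ∈-downFrom⁺ y≤k
choices-complete (plateau m) _ y≤c = ∈-downFrom⁺ (s≤s y≤c)
choices-complete (descent m) _ y≤c = ∈-downFrom⁺ (s≤s y≤c)
choices-complete (twoValued v) _ (inj₁ refl) = here refl
choices-complete (twoValued v) _ (inj₂ refl) = there (here refl)
choices-complete frozen _ refl = here refl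

choices-unique : ∀ s k → Unique (choices s k)
choices-unique zeros k = downFrom⁺ (suc k)
choices-unique (plateau m) _ = downFrom⁺ (suc (suc m))
choices-unique (descent m) _ = downFrom⁺ (suc (suc m))
choices-unique (twoValued v) _ = ((λ ()) ∷ []) ∷ [] ∷ []
choices-unique frozen _ = [] ∷ []

children : ∀ {k} → Vec ℕ k × Shape → List (Vec ℕ (suc k) × Shape)
children {k} (e , s) = map (λ y → e ∷ʳ y , step s y) (choices s k)

avoiders : (n : ℕ) → List (Vec ℕ (suc n) × Shape)
avoiders zero = (0 ∷ [] , zeros) ∷ []
avoiders (suc n) = concatMap children (avoiders n)

∈-children⁻ : ∀ {k} {e : Vec ℕ k} {s q} → q ∈ children (e , s) →
              ∃[ y ] (y ∈ choices s k × q ≡ (e ∷ʳ y , step s y))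
∈-children⁻ = ∈-map⁻ _

∈-concatMap-children⁻ : ∀ {k} {ps : List (Vec ℕ k × Shape)} {q} → q ∈ concatMap children ps →
                        ∃[ e ] ∃[ s ] ∃[ y ] ((e , s) ∈ ps × y ∈ choices s k × q ≡ (e ∷ʳ y , step s y))
∈-concatMap-children⁻ {ps = ps} q∈ with find (∈-concatMap⁻ children {xs = ps} q∈)
... | (e , s) , p∈ , q∈children with ∈-children⁻ {e = e} {s} q∈children
...   | y , y∈ , refl = e , s , y , p∈ , y∈ , refl

∈-avoiders⇒tracks : ∀ n {e s} → (e , s) ∈ avoiders n → Tracks e s
∈-avoiders⇒tracks zero (here refl) = tracks-[0]
∈-avoiders⇒tracks (suc n) q∈ with ∈-concatMap-children⁻ {ps = avoiders n} q∈
... | e , s , y , p∈ , y∈ , refl =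
  let t = ∈-avoiders⇒tracks n p∈
      y≤1+k , ay = choices-sound s (Tracks.bounded t) y∈
  in tracks-∷ʳ t y≤1+k ay

avoiders-complete : ∀ n (e : Vec ℕ (suc n)) → IsInvSeq e → Avoids e →
                    ∃[ s ] (e , s) ∈ avoiders n
avoiders-complete zero (y ∷ []) inv _ with isInvSeq⇒head≡0 {e = y ∷ []} inv
... | refl = zeros , here refl
avoiders-complete (suc n) e inv avoids with initLast e
... | e′ , y , refl =
  let inv′ , y≤1+n = isInvSeq⁻ inv
      s , p∈ = avoiders-complete n e′ inv′ (avoids ∘ hasPattern⁺)
      t = ∈-avoiders⇒tracks n p∈
      ay = decidable-stable (allowed? s y)
             (avoids ∘ forbidden⇒hasPattern ∘ Tracks.¬allowed⇒forbidden t)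
  in step s y , ∈-concatMap⁺ children (lose p∈ (∈-map⁺ _ (choices-complete s y≤1+n ay)))
  where open Snoc e′ y

children-unique : ∀ {k} (ps : List (Vec ℕ k × Shape)) → Unique (map proj₁ ps) →
                  Unique (map proj₁ (concatMap children ps))
children-unique [] _ = []
children-unique {k} ((e , s) ∷ ps) (e∉ps ∷ ps-unique)
  rewrite map-++ proj₁ (children (e , s)) (concatMap children ps) =
  ++⁺ own (children-unique ps ps-unique) disjoint
  where
  own : Unique (map proj₁ (children (e , s)))
  own = subst Unique (map-∘ (choices s k)) (map⁺ (∷ʳ-injectiveʳ e e) (choices-unique s k))

  disjoint : ∀ {e′} → ¬ (e′ ∈ map proj₁ (children (e , s)) × e′ ∈ map proj₁ (concatMap children ps))
  disjoint (e′∈₁ , e′∈₂) with ∈-map⁻ proj₁ e′∈₁ | ∈-map⁻ proj₁ e′∈₂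
  ... | q₁ , q₁∈ , refl | q₂ , q₂∈ , e′≡
    with ∈-children⁻ {e = e} {s} q₁∈ | ∈-concatMap-children⁻ {ps = ps} q₂∈
  ... | _ , _ , refl | r , _ , _ , r∈ , _ , refl =
    All.lookup e∉ps (∈-map⁺ proj₁ r∈) (∷ʳ-injectiveˡ e r e′≡)

avoiders-unique : ∀ n → Unique (map proj₁ (avoiders n))
avoiders-unique zero = [] ∷ []
avoiders-unique (suc n) = children-unique (avoiders n) (avoiders-unique n)

-- Counting

sum-map-+ : ∀ {A : Set} (f g : A → ℕ) xs →
            sum (map (λ x → f x + g x) xs) ≡ sum (map f xs) + sum (map g xs)
sum-map-+ f g [] = refl
sum-map-+ f g (x ∷ xs) =
  trans (cong (f x + g x +_) (sum-map-+ f g xs)) (interchange +-commutativeSemigroup (f x) (g x) _ _)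

sum-map-cong : ∀ {A : Set} {f g : A → ℕ} → (∀ x → f x ≡ g x) → ∀ xs →
               sum (map f xs) ≡ sum (map g xs)
sum-map-cong f≗g xs = cong sum (map-cong f≗g xs)

sum-map-concatMap : ∀ {A B : Set} (f : B → ℕ) (g : A → List B) xs →
                    sum (map f (concatMap g xs)) ≡ sum (map (λ x → sum (map f (g x))) xs)
sum-map-concatMap f g [] = refl
sum-map-concatMap f g (x ∷ xs) = begin
  sum (map f (g x ++ concatMap g xs))               ≡⟨ cong sum (map-++ f (g x) (concatMap g xs)) ⟩
  sum (map f (g x) ++ map f (concatMap g xs))       ≡⟨ sum-++ (map f (g x)) _ ⟩
  sum (map f (g x)) + sum (map f (concatMap g xs))  ≡⟨ cong (sum (map f (g x)) +_) (sum-map-concatMap f g xs) ⟩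
  sum (map f (g x)) + sum (map (λ x → sum (map f (g x))) xs) ∎
  where open ≡-Reasoning

length≡sum-map-1 : ∀ {A : Set} (xs : List A) → length xs ≡ sum (map (λ _ → 1) xs)
length≡sum-map-1 [] = refl
length≡sum-map-1 (x ∷ xs) = cong suc (length≡sum-map-1 xs)

sumBelow : ℕ → (ℕ → ℕ) → ℕ
sumBelow k f = sum (map f (downFrom k))

sumBelow-const : ∀ k c → sumBelow k (λ _ → c) ≡ c * k
sumBelow-const zero c = sym (*-zeroʳ c)
sumBelow-const (suc k) c = trans (cong (c +_) (sumBelow-const k c)) (sym (*-suc c k))

sumBelow-shift : ∀ k f → sumBelow (suc k) f ≡ f 0 + sumBelow k (f ∘ suc)
sumBelow-shift zero f = refl
sumBelow-shift (suc k) f =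
  trans (cong (f (suc k) +_) (sumBelow-shift k f)) (x∙yz≈y∙xz +-commutativeSemigroup (f (suc k)) (f 0) _)

sumBelow-cong : ∀ k {f g} → (∀ i → i < k → f i ≡ g i) → sumBelow k f ≡ sumBelow k g
sumBelow-cong zero _ = refl
sumBelow-cong (suc k) f≗g =
  cong₂ _+_ (f≗g k (n<1+n k)) (sumBelow-cong k (λ i i<k → f≗g i (m<n⇒m<1+n i<k)))

doublingSum : (ℕ → ℕ) → ℕ → ℕ
doublingSum f zero = 0
doublingSum f (suc n) = 2 * doublingSum f n + f n

doublingSum-partialSums : ∀ f n →
  sumBelow (suc n) f + doublingSum (λ m → sumBelow (suc m) f) n ≡ doublingSum f (suc n)
doublingSum-partialSums f zero = trans (+-identityʳ _) (+-identityʳ _)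
doublingSum-partialSums f (suc n) = begin
  f (suc n) + S + (2 * D + S) ≡⟨ rearrange (f (suc n)) S D ⟩
  2 * (S + D) + f (suc n)     ≡⟨ cong (λ t → 2 * t + f (suc n)) (doublingSum-partialSums f n) ⟩
  doublingSum f (suc (suc n)) ∎
  where
  open ≡-Reasoning
  S D : ℕ
  S = sumBelow (suc n) f
  D = doublingSum (λ m → sumBelow (suc m) f) n
  rearrange : ∀ a b c → a + b + (2 * c + b) ≡ 2 * (b + c) + a
  rearrange = solve-∀

doublingSum-suc : ∀ n → doublingSum suc n + n + 2 ≡ 2 ^ suc n
doublingSum-suc zero = refl
doublingSum-suc (suc n) = trans (rearrange (doublingSum suc n) n) (cong (2 *_) (doublingSum-suc n))
  where
  rearrange : ∀ d n → 2 * d + suc n + suc n + 2 ≡ 2 * (d + n + 2)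
  rearrange = solve-∀

n+nC2≡[1+n]C2 : ∀ n → n + n C 2 ≡ suc n C 2
n+nC2≡[1+n]C2 n = trans (cong (_+ n C 2) (sym (nC1≡n n))) (nCk+nC[k+1]≡[n+1]C[k+1] n 1)

Weight : Set
Weight = Shape → ℕ

mass : Weight → ℕ → ℕ
mass w n = sum (map (w ∘ proj₂) (avoiders n))

mass-+ : ∀ v w n → mass (λ s → v s + w s) n ≡ mass v n + mass w n
mass-+ v w n = sum-map-+ (v ∘ proj₂) (w ∘ proj₂) (avoiders n)

push : ℕ → Weight → Weight
push k w s = sum (map (w ∘ step s) (choices s k))

mass-suc : ∀ w n → mass w (suc n) ≡ mass (push (suc n) w) n
mass-suc w n =
  trans (sum-map-concatMap (w ∘ proj₂) children (avoiders n))
        (sum-map-cong (λ { (_ , s) → cong sum (sym (map-∘ (choices s (suc n)))) }) (avoiders n))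

mass-push : ∀ {w v} n → (∀ s → push (suc n) w s ≡ v s) → mass w (suc n) ≡ mass v n
mass-push {w} n push≗ = trans (mass-suc w n) (sum-map-cong (push≗ ∘ proj₂) (avoiders n))

step-plateau-self : ∀ m → step (plateau m) (suc m) ≡ plateau m
step-plateau-self m with m ≟ m
... | yes _ = refl
... | no m≢m = contradiction refl m≢m

step-plateau-below : ∀ {m j} → j < m → step (plateau m) (suc j) ≡ descent j
step-plateau-below {m} {j} j<m with j ≟ m
... | yes refl = contradiction j<m (<-irrefl refl)
... | no _ = refl

push-zeros : ∀ k w → push k w zeros ≡ w zeros + sumBelow k (w ∘ plateau)
push-zeros k w = sumBelow-shift k (w ∘ step zeros)

push-plateau : ∀ k w m →
  push k w (plateau m) ≡ w (plateau m) + (w (twoValued m) + sumBelow m (w ∘ descent))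
push-plateau k w m =
  cong₂ _+_ (cong w (step-plateau-self m))
    (trans (sumBelow-shift m (w ∘ step (plateau m)))
           (cong (w (twoValued m) +_) (sumBelow-cong m (λ j j<m → cong w (step-plateau-below j<m)))))

push-descent : ∀ k w m → push k w (descent m) ≡ w frozen + sumBelow (suc m) (w ∘ descent)
push-descent k w m = sumBelow-shift (suc m) (w ∘ step (descent m))

onZeros : ℕ → Weight
onZeros c zeros = c
onZeros c _ = 0

isPlateau isTwoValued one : Weight
isPlateau (plateau _) = 1
isPlateau _ = 0
isTwoValued (twoValued _) = 1
isTwoValued _ = 0
one _ = 1

byHeight : (ℕ → ℕ) → Weight
byHeight f (plateau m) = f m
byHeight f (descent m) = f m
byHeight f _ = 0

push-onZeros : ∀ k c s → push k (onZeros c) s ≡ onZeros c s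
push-onZeros k c zeros =
  trans (push-zeros k (onZeros c)) (trans (cong (c +_) (sumBelow-const k 0)) (+-identityʳ c))
push-onZeros k c (plateau m) = trans (push-plateau k (onZeros c) m) (sumBelow-const m 0)
push-onZeros k c (descent m) = trans (push-descent k (onZeros c) m) (sumBelow-const (suc m) 0)
push-onZeros k c (twoValued v) = refl
push-onZeros k c frozen = refl

push-isPlateau : ∀ k s → push k isPlateau s ≡ onZeros k s + isPlateau s
push-isPlateau k zeros = trans (push-zeros k isPlateau) (sumBelow-const k 1)
push-isPlateau k (plateau m) = trans (push-plateau k isPlateau m) (cong suc (sumBelow-const m 0))
push-isPlateau k (descent m) = trans (push-descent k isPlateau m) (sumBelow-const (suc m) 0)
push-isPlateau k (twoValued v) = refl
push-isPlateau k frozen = refl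

push-isTwoValued : ∀ k s → push k isTwoValued s ≡ isPlateau s + (isTwoValued s + isTwoValued s)
push-isTwoValued k zeros = trans (push-zeros k isTwoValued) (sumBelow-const k 0)
push-isTwoValued k (plateau m) = trans (push-plateau k isTwoValued m) (cong suc (sumBelow-const m 0))
push-isTwoValued k (descent m) = trans (push-descent k isTwoValued m) (sumBelow-const (suc m) 0)
push-isTwoValued k (twoValued v) = refl
push-isTwoValued k frozen = refl

push-byHeight : ∀ k f s →
  push k (byHeight f) s ≡ onZeros (sumBelow k f) s + byHeight (λ m → sumBelow (suc m) f) s
push-byHeight k f zeros = trans (push-zeros k (byHeight f)) (sym (+-identityʳ _))
push-byHeight k f (plateau m) = push-plateau k (byHeight f) m
push-byHeight k f (descent m) = push-descent k (byHeight f) m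
push-byHeight k f (twoValued v) = refl
push-byHeight k f frozen = refl

push-one : ∀ k s → push k one s ≡ suc (onZeros k s + (isTwoValued s + byHeight suc s))
push-one k zeros = trans (push-zeros k one) (cong suc (sumBelow-const k 1))
push-one k (plateau m) =
  trans (push-plateau k one m) (cong (2 +_) (trans (sumBelow-const m 1) (+-identityʳ m)))
push-one k (descent m) =
  trans (push-descent k one m) (cong (2 +_) (trans (sumBelow-const m 1) (+-identityʳ m)))
push-one k (twoValued v) = refl
push-one k frozen = refl

mass-onZeros : ∀ c n → mass (onZeros c) n ≡ c
mass-onZeros c zero = +-identityʳ c
mass-onZeros c (suc n) = trans (mass-push n (push-onZeros (suc n) c)) (mass-onZeros c n)

mass-isPlateau : ∀ n → mass isPlateau n ≡ suc n C 2
mass-isPlateau zero = refl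
mass-isPlateau (suc n) = begin
  mass isPlateau (suc n)                         ≡⟨ mass-push n (push-isPlateau (suc n)) ⟩
  mass (λ s → onZeros (suc n) s + isPlateau s) n ≡⟨ mass-+ (onZeros (suc n)) isPlateau n ⟩
  mass (onZeros (suc n)) n + mass isPlateau n    ≡⟨ cong₂ _+_ (mass-onZeros (suc n) n) (mass-isPlateau n) ⟩
  suc n + suc n C 2                              ≡⟨ n+nC2≡[1+n]C2 (suc n) ⟩
  suc (suc n) C 2                                ∎
  where open ≡-Reasoning

mass-isTwoValued-suc : ∀ n → mass isTwoValued (suc n) ≡ suc n C 2 + (mass isTwoValued n + mass isTwoValued n)
mass-isTwoValued-suc n = begin
  mass isTwoValued (suc n)
    ≡⟨ mass-push n (push-isTwoValued (suc n)) ⟩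
  mass (λ s → isPlateau s + (isTwoValued s + isTwoValued s)) n
    ≡⟨ mass-+ isPlateau _ n ⟩
  mass isPlateau n + mass (λ s → isTwoValued s + isTwoValued s) n
    ≡⟨ cong₂ _+_ (mass-isPlateau n) (mass-+ isTwoValued isTwoValued n) ⟩
  suc n C 2 + (mass isTwoValued n + mass isTwoValued n) ∎
  where open ≡-Reasoning

mass-isTwoValued : ∀ n → mass isTwoValued n + 1 + suc (suc n) C 2 ≡ 2 ^ suc n
mass-isTwoValued zero = refl
mass-isTwoValued (suc n) = begin
  mass isTwoValued (suc n) + 1 + c₃
    ≡⟨ cong (λ t → t + 1 + c₃) (mass-isTwoValued-suc n) ⟩
  c₁ + (E + E) + 1 + c₃
    ≡⟨ cong (c₁ + (E + E) + 1 +_) (sym c₂→c₃) ⟩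
  c₁ + (E + E) + 1 + (suc (suc n) + c₂)
    ≡⟨ cong (λ t → c₁ + (E + E) + 1 + (suc (suc n) + t)) (sym c₁→c₂) ⟩
  c₁ + (E + E) + 1 + (suc (suc n) + (suc n + c₁))
    ≡⟨ rearrange c₁ E n ⟩
  2 * (E + 1 + (suc n + c₁))
    ≡⟨ cong (λ t → 2 * (E + 1 + t)) c₁→c₂ ⟩
  2 * (E + 1 + c₂)
    ≡⟨ cong (2 *_) (mass-isTwoValued n) ⟩
  2 ^ suc (suc n) ∎
  where
  open ≡-Reasoning
  E c₁ c₂ c₃ : ℕ
  E = mass isTwoValued n
  c₁ = suc n C 2
  c₂ = suc (suc n) C 2
  c₃ = suc (suc (suc n)) C 2
  c₁→c₂ : suc n + c₁ ≡ c₂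
  c₁→c₂ = n+nC2≡[1+n]C2 (suc n)
  c₂→c₃ : suc (suc n) + c₂ ≡ c₃
  c₂→c₃ = n+nC2≡[1+n]C2 (suc (suc n))
  rearrange : ∀ c e n → c + (e + e) + 1 + (suc (suc n) + (suc n + c)) ≡ 2 * (e + 1 + (suc n + c))
  rearrange = solve-∀

mass-byHeight : ∀ f n → mass (byHeight f) n ≡ doublingSum f n
mass-byHeight f zero = refl
mass-byHeight f (suc n) = begin
  mass (byHeight f) (suc n)                 ≡⟨ mass-push n (push-byHeight (suc n) f) ⟩
  mass (λ s → onZeros S s + byHeight g s) n ≡⟨ mass-+ (onZeros S) (byHeight g) n ⟩
  mass (onZeros S) n + mass (byHeight g) n  ≡⟨ cong₂ _+_ (mass-onZeros S n) (mass-byHeight g n) ⟩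
  S + doublingSum g n                       ≡⟨ doublingSum-partialSums f n ⟩
  doublingSum f (suc n)                     ∎
  where
  open ≡-Reasoning
  S : ℕ
  S = sumBelow (suc n) f
  g : ℕ → ℕ
  g m = sumBelow (suc m) f

mass-one-suc : ∀ n → mass one (suc n) ≡ mass one n + (suc n + (mass isTwoValued n + doublingSum suc n))
mass-one-suc n = begin
  mass one (suc n)
    ≡⟨ mass-push n (push-one (suc n)) ⟩
  mass (λ s → one s + (onZeros (suc n) s + rest s)) n
    ≡⟨ mass-+ one _ n ⟩
  mass one n + mass (λ s → onZeros (suc n) s + rest s) n
    ≡⟨ cong (mass one n +_) (mass-+ (onZeros (suc n)) rest n) ⟩
  mass one n + (mass (onZeros (suc n)) n + mass rest n)
    ≡⟨ cong (λ t → mass one n + (t + mass rest n)) (mass-onZeros (suc n) n) ⟩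
  mass one n + (suc n + mass rest n)
    ≡⟨ cong (λ t → mass one n + (suc n + t)) rest-mass ⟩
  mass one n + (suc n + (mass isTwoValued n + doublingSum suc n)) ∎
  where
  open ≡-Reasoning
  rest : Weight
  rest s = isTwoValued s + byHeight suc s
  rest-mass : mass rest n ≡ mass isTwoValued n + doublingSum suc n
  rest-mass = trans (mass-+ isTwoValued (byHeight suc) n) (cong (mass isTwoValued n +_) (mass-byHeight suc n))

mass-one : ∀ n → mass one n + 1 + 2 * suc n + suc (suc n) C 3 ≡ 2 ^ suc (suc n)
mass-one zero = refl
mass-one (suc n) = begin
  mass one (suc n) + 1 + 2 * suc (suc n) + suc (suc (suc n)) C 3
    ≡⟨ cong₂ (λ t c → t + 1 + 2 * suc (suc n) + c) (mass-one-suc n)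
             (sym (nCk+nC[k+1]≡[n+1]C[k+1] (suc (suc n)) 2)) ⟩
  T + (suc n + (E + D)) + 1 + 2 * suc (suc n) + (c₂ + c₃)
    ≡⟨ rearrange T E D c₂ c₃ n ⟩
  (T + 1 + 2 * suc n + c₃) + (D + n + 2) + (E + 1 + c₂)
    ≡⟨ cong₂ (λ a b → a + b + (E + 1 + c₂)) (mass-one n) (doublingSum-suc n) ⟩
  2 ^ suc (suc n) + 2 ^ suc n + (E + 1 + c₂)
    ≡⟨ cong (2 ^ suc (suc n) + 2 ^ suc n +_) (mass-isTwoValued n) ⟩
  2 ^ suc (suc n) + 2 ^ suc n + 2 ^ suc n
    ≡⟨ double (2 ^ suc n) ⟩
  2 ^ suc (suc (suc n)) ∎
  where
  open ≡-Reasoning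
  T E D c₂ c₃ : ℕ
  T = mass one n
  E = mass isTwoValued n
  D = doublingSum suc n
  c₂ = suc (suc n) C 2
  c₃ = suc (suc n) C 3
  rearrange : ∀ t e d a b n → t + (suc n + (e + d)) + 1 + 2 * suc (suc n) + (a + b) ≡
                              (t + 1 + 2 * suc n + b) + (d + n + 2) + (e + 1 + a)
  rearrange = solve-∀
  double : ∀ p → 2 * p + p + p ≡ 2 * (2 * p)
  double = solve-∀

m+n+o+p∸p∸o∸n≡m : ∀ m n o p → m + n + o + p ∸ p ∸ o ∸ n ≡ m
m+n+o+p∸p∸o∸n≡m m n o p rewrite m+n∸n≡m (m + n + o) p | m+n∸n≡m (m + n) o = m+n∸n≡m m n

sequences : (n : ℕ) → List (Vec ℕ (suc n))
sequences n = map proj₁ (avoiders n)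

∈-sequences⁻ : ∀ n {e} → e ∈ sequences n → IsInvSeq e × Avoids e
∈-sequences⁻ n e∈ with ∈-map⁻ proj₁ e∈
... | _ , p∈ , refl = let t = ∈-avoiders⇒tracks n p∈ in Tracks.isInvSeq t , Tracks.avoids t

∈-sequences⁺ : ∀ n {e} → IsInvSeq e → Avoids e → e ∈ sequences n
∈-sequences⁺ n {e} inv avoids = ∈-map⁺ proj₁ (proj₂ (avoiders-complete n e inv avoids))

length-sequences : ∀ n → length (sequences n) ≡ 2 ^ suc (suc n) ∸ suc (suc n) C 3 ∸ 2 * suc n ∸ 1
length-sequences n = begin
  length (sequences n)
    ≡⟨ length-map proj₁ (avoiders n) ⟩
  length (avoiders n)
    ≡⟨ length≡sum-map-1 (avoiders n) ⟩
  mass one n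
    ≡⟨ m+n+o+p∸p∸o∸n≡m (mass one n) 1 (2 * suc n) (suc (suc n) C 3) ⟨
  mass one n + 1 + 2 * suc n + suc (suc n) C 3 ∸ suc (suc n) C 3 ∸ 2 * suc n ∸ 1
    ≡⟨ cong (λ t → t ∸ suc (suc n) C 3 ∸ 2 * suc n ∸ 1) (mass-one n) ⟩
  2 ^ suc (suc n) ∸ suc (suc n) C 3 ∸ 2 * suc n ∸ 1 ∎
  where open ≡-Reasoning

mainTheorem8 : (n : ℕ) → n ≥ 1 →
    Σ (List (Seq n)) λ L →
      Unique L ×
      ((e : Seq n) → (e ∈ L → IsInvSeq e × Avoids e) × (IsInvSeq e → Avoids e → e ∈ L)) ×
      length L ≡ 2 ^ (n + 1) ∸ ((n + 1) C 3) ∸ 2 * n ∸ 1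
mainTheorem8 zero ()
mainTheorem8 (suc n) _ rewrite +-comm n 1 =
  sequences n , avoiders-unique n , (λ e → ∈-sequences⁻ n , ∈-sequences⁺ n) , length-sequences n
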